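{- Let $T$ be the set of $n\in\mathbb{N}$ whose binary expansion contains an even number of digits $1$ (so $T=\{0,3,5,6,9,10,12,15,\dots\}$), and let $\bar T$ be its reciprocal. Then \[ \bar T=\{0\}\cup\{4k\pm1: k\ge1 \text{ and the binary expansion of } k \text{ ends in an even number of } 0\text{s}\}, \] where the number of trailing zeros of $k$ is allowed to be $0$. Consequently, $\delta(\bar T)=1/3$.
   Context: $\mathbb{N}=\{0,1,2,\dots\}$. For $A\subseteq\mathbb{N}$ with $0\in A$, the reciprocal $\bar A$ is the unique set $B\subseteq\mathbb{N}$ with $\big(\sum_{a\in A}q^a\big)\big(\sum_{b\in B}q^b\big)=1$ in $\mathbb{F}_2[[q]]$. For $B\subseteq\mathbb{N}$, $\delta(B)=\lim_{n\to\infty}|B\cap[0,n]|/(n+1)$. -}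

module Defs where

open import Data.Bool using (Bool; true; false; _∧_; _xor_; if_then_else_)
open import Data.Nat using (ℕ; zero; suc; _+_; _*_; _∸_; _≤_; _%_; _/_; _≡ᵇ_)
open import Data.Nat.Divisibility using (_∣_)
open import Data.List using (foldr; map; upTo)
open import Data.Product using (∃; _×_)
open import Data.Sum using (_⊎_)
open import Data.Integer using (+_)
open import Data.Rational using (ℚ; 0ℚ; _<_; ∣_∣; _-_)
import Data.Rational as ℚ
open import Relation.Binary.PropositionalEquality using (_≡_)

Subset : Set
Subset = ℕ → Bool

-- Number of 1-digits in the binary expansion of n, computed with fuel f
-- (fuel f = n suffices, since n has at most n binary digits).
onesF : ℕ → ℕ → ℕ
onesF zero    n = 0
onesF (suc f) n = n % 2 + onesF f (n / 2)

ones : ℕ → ℕ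
ones n = onesF n n

T : Subset
T n = (ones n % 2) ≡ᵇ 0

-- Number of trailing zeros of k (for k ≥ 1), computed with fuel f
-- (fuel f = k suffices).
trailingZerosF : ℕ → ℕ → ℕ
trailingZerosF zero    k = 0
trailingZerosF (suc f) zero = 0
trailingZerosF (suc f) (suc k) =
  if (suc k % 2) ≡ᵇ 0 then suc (trailingZerosF f (suc k / 2)) else 0

trailingZeros : ℕ → ℕ
trailingZeros k = trailingZerosF k k

-- Coefficient of q^n in the product (Σ_{a∈A} q^a)(Σ_{b∈B} q^b) over 𝔽₂:
-- parity of #{ i ≤ n | i ∈ A, n - i ∈ B }.
conv : Subset → Subset → ℕ → Bool
conv A B n = foldr _xor_ false (map (λ i → A i ∧ B (n ∸ i)) (upTo (suc n)))

one : ℕ → Bool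
one zero    = true
one (suc n) = false

IsReciprocal : Subset → Subset → Set
IsReciprocal A B = ∀ n → conv A B n ≡ one n

InTbar : ℕ → Set
InTbar n = n ≡ 0
         ⊎ ∃ λ k → 1 ≤ k × 2 ∣ trailingZeros k × (n ≡ 4 * k + 1 ⊎ n + 1 ≡ 4 * k)

count : Subset → ℕ → ℕ
count B n = foldr _+_ 0 (map (λ i → if B i then 1 else 0) (upTo (suc n)))

HasDensity : Subset → ℚ → Set
HasDensity B d =
  ∀ (ε : ℚ) → 0ℚ < ε → ∃ λ N → ∀ n → N ≤ n →
    ∣ (+ count B n ℚ./ suc n) - d ∣ < ε

{-# OPTIONS --safe #-}

-- Read subsets of ℕ as power series over 𝔽₂, so that shift is multiplication by q and Δ by 1 + q.
-- Let G = EvenTZ be the set of k ≥ 1 with an even number of trailing binary zeros. The digit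
-- recursions T (2k) = T k, T (2k+1) = ¬ T k turn into (1 + q) T = 1 + G, and G (2k+1) = 1,
-- G (2k) = ¬ G k together with the Frobenius identity G² = G (q²) give (1 + q) (G + G²) = q.
-- Hence T̄ = (1 + q)² G / q satisfies q (1 + q) T T̄ = (1 + G) G (1 + q)² = q (1 + q), so T T̄ = 1;
-- the coefficient G (n+1) + G (n-1) of T̄ is 1 exactly at n = 0, at 4k+1 when G k, and at
-- 4k-1 when G k. For the density, g k = |G ∩ [1,k]| obeys g (2k) + g k = 2k, so |3 g k - 2k| is
-- at most the number of binary 1s of k, which is O(√k); as |T̄ ∩ [0,4K+1]| = 1 + 2 g K, T̄ has
-- density 1/3.
module Submission where

open import Defs
open import Algebra.Bundles using (CommutativeRing)
open import Data.Bool using (Bool; true; false; not; _∧_; _xor_; if_then_else_)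
open import Data.Bool.Properties
  using (T-≡; ∧-comm; ∧-idem; ∧-distribʳ-xor; xor-comm; xor-assoc; xor-same; xor-identityʳ; xor-inverseˡ;
         not-involutive; not-distribʳ-xor; xor-∧-commutativeRing)
open import Algebra.Properties.CommutativeSemigroup
  (CommutativeRing.+-commutativeSemigroup xor-∧-commutativeRing) using (interchange; x∙yz≈y∙xz)
open import Data.Bool.Solver using (module xor-∧-Solver)
open import Data.Integer as ℤ using (+_; +[1+_]; -[1+_]; _⊖_)
open import Data.Integer.Properties as ℤ using ()
open import Data.List using (foldr; map; applyUpTo; upTo; _++_; [_])
open import Data.List.Properties using (map-applyUpTo; applyUpTo-∷ʳ; map-++; map-cong)
open import Data.Nat using (ℕ; zero; suc; _+_; _*_; _∸_; _≤_; _<_; _≤?_; z≤n; s≤s; _≡ᵇ_; ∣_-_∣)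
import Data.Nat as ℕ
open import Data.Nat.DivMod using (m*n%n≡0; [m+kn]%n≡m%n; m*n/n≡m; +-distrib-/; m/n<m)
open import Data.Nat.Divisibility using (_∣_; m%n≡0⇔n∣m)
open import Data.Nat.Induction using (<-rec)
open import Data.Nat.ListAction using (sum)
open import Data.Nat.ListAction.Properties using (sum-++)
open import Data.Nat.Properties
open import Data.Nat.Tactic.RingSolver using (solve-∀)
open import Data.Product using (∃; _×_; _,_; proj₁; proj₂)
open import Data.Rational as ℚ using (mkℚ; 0ℚ; _/_)
open import Data.Rational.Properties as ℚ using ()
open import Data.Rational.Unnormalised as ℚᵘ using (ℚᵘ; mkℚᵘ)
open import Data.Rational.Unnormalised.Properties as ℚᵘ using ()
open import Data.Sum using (inj₁; inj₂)
open import Function using (_∘_)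
open import Function.Bundles using (_⇔_; mk⇔; Equivalence)
import Function.Properties.Equivalence as ⇔
open import Relation.Binary.PropositionalEquality
  using (_≡_; refl; sym; trans; cong; cong₂; subst; subst₂; _≗_; _→-setoid_; module ≡-Reasoning)
open import Relation.Nullary using (yes; no)

private
  variable
    A A′ B B′ E : Subset

-- The ring 𝔽₂[[q]]

infixl 6 _⊕_
infixl 7 _·_

_⊕_ : Subset → Subset → Subset
(A ⊕ B) n = A n xor B n

𝟘 : Subset
𝟘 _ = false

shift tail : Subset → Subset
shift A zero    = false
shift A (suc n) = A n
tail A n = A (suc n)

-- Unfolded along A = A 0 + q · tail A.
_·_ : Subset → Subset → Subset
(A · B) zero    = A 0 ∧ B 0
(A · B) (suc n) = (A 0 ∧ B (suc n)) xor (tail A · B) n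

conv≗· : ∀ A B → conv A B ≗ A · B
conv≗· A B n = trans (cong (foldr _xor_ false) (map-applyUpTo (λ i → i) (λ i → A i ∧ B (n ∸ i)) (suc n))) (xor-sum n A B)
  where
  xor-sum : ∀ n A B → foldr _xor_ false (applyUpTo (λ i → A i ∧ B (n ∸ i)) (suc n)) ≡ (A · B) n
  xor-sum zero    A B = xor-identityʳ (A 0 ∧ B 0)
  xor-sum (suc n) A B = cong ((A 0 ∧ B (suc n)) xor_) (xor-sum n (tail A) B)

⊕-cong : A ≗ A′ → B ≗ B′ → A ⊕ B ≗ A′ ⊕ B′
⊕-cong eqA eqB n = cong₂ _xor_ (eqA n) (eqB n)

shift-cong : A ≗ B → shift A ≗ shift B
shift-cong eq zero    = refl
shift-cong eq (suc n) = eq n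

·-cong : A ≗ A′ → B ≗ B′ → A · B ≗ A′ · B′
·-cong eqA eqB zero    = cong₂ _∧_ (eqA 0) (eqB 0)
·-cong eqA eqB (suc n) =
  cong₂ _xor_ (cong₂ _∧_ (eqA 0) (eqB (suc n))) (·-cong (λ i → eqA (suc i)) eqB n)

·-distribʳ-⊕ : ∀ A A′ B → (A ⊕ A′) · B ≗ A · B ⊕ A′ · B
·-distribʳ-⊕ A A′ B zero    = ∧-distribʳ-xor (B 0) (A 0) (A′ 0)
·-distribʳ-⊕ A A′ B (suc n) =
  trans (cong₂ _xor_ (∧-distribʳ-xor (B (suc n)) (A 0) (A′ 0)) (·-distribʳ-⊕ (tail A) (tail A′) B n))
        (interchange (A 0 ∧ B (suc n)) (A′ 0 ∧ B (suc n)) ((tail A · B) n) ((tail A′ · B) n))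

·-unfoldʳ : ∀ A B n → (A · B) (suc n) ≡ (A (suc n) ∧ B 0) xor (A · tail B) n
·-unfoldʳ A B zero    = xor-comm (A 0 ∧ B 1) (A 1 ∧ B 0)
·-unfoldʳ A B (suc n) =
  trans (cong ((A 0 ∧ B (suc (suc n))) xor_) (·-unfoldʳ (tail A) B n))
        (x∙yz≈y∙xz (A 0 ∧ B (suc (suc n))) (A (suc (suc n)) ∧ B 0) ((tail A · tail B) n))

·-comm : ∀ A B → A · B ≗ B · A
·-comm A B zero    = ∧-comm (A 0) (B 0)
·-comm A B (suc n) =
  trans (cong₂ _xor_ (∧-comm (A 0) (B (suc n))) (·-comm (tail A) B n)) (sym (·-unfoldʳ B A n))

·-distribˡ-⊕ : ∀ A B B′ → A · (B ⊕ B′) ≗ A · B ⊕ A · B′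
·-distribˡ-⊕ A B B′ n =
  trans (·-comm A (B ⊕ B′) n)
        (trans (·-distribʳ-⊕ B B′ A n) (cong₂ _xor_ (·-comm B A n) (·-comm B′ A n)))

·-identityˡ : ∀ A → one · A ≗ A
·-identityˡ A zero    = refl
·-identityˡ A (suc n) = trans (cong (A (suc n) xor_) (·-zeroˡ n)) (xor-identityʳ (A (suc n)))
  where
  ·-zeroˡ : ∀ n → (𝟘 · A) n ≡ false
  ·-zeroˡ zero    = refl
  ·-zeroˡ (suc n) = ·-zeroˡ n

shift-·ˡ : ∀ A B → shift A · B ≗ shift (A · B)
shift-·ˡ A B zero    = refl
shift-·ˡ A B (suc n) = refl

shift-·ʳ : ∀ A B → A · shift B ≗ shift (A · B)
shift-·ʳ A B n = trans (·-comm A (shift B) n) (trans (shift-·ˡ B A n) (shift-cong (·-comm B A) n))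

xor-cancelʳ : ∀ a b → (a xor b) xor b ≡ a
xor-cancelʳ a b = trans (xor-assoc a b b) (trans (cong (a xor_) (xor-same b)) (xor-identityʳ a))

·≗𝟘⇒≗𝟘 : A 0 ≡ true → A · E ≗ 𝟘 → E ≗ 𝟘
·≗𝟘⇒≗𝟘 {A} {E} A₀ AE≗𝟘 zero    = subst (λ a → a ∧ E 0 ≡ false) A₀ (AE≗𝟘 0)
·≗𝟘⇒≗𝟘 {A} {E} A₀ AE≗𝟘 (suc n) = ·≗𝟘⇒≗𝟘 A₀ A·tailE≗𝟘 n
  where
  E≗shift-tail : E ≗ shift (tail E)
  E≗shift-tail zero    = ·≗𝟘⇒≗𝟘 A₀ AE≗𝟘 0
  E≗shift-tail (suc m) = refl
  A·tailE≗𝟘 : A · tail E ≗ 𝟘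
  A·tailE≗𝟘 m = begin
    (A · tail E) m                ≡⟨ shift-·ʳ A (tail E) (suc m) ⟨
    (A · shift (tail E)) (suc m)  ≡⟨ ·-cong {A} {A} (λ _ → refl) E≗shift-tail (suc m) ⟨
    (A · E) (suc m)               ≡⟨ AE≗𝟘 (suc m) ⟩
    false                         ∎
    where open ≡-Reasoning

reciprocal-unique : A 0 ≡ true → A · B ≗ one → A · B′ ≗ one → B ≗ B′
reciprocal-unique {A} {B} {B′} A₀ AB≗one AB′≗one n =
  trans (sym (xor-cancelʳ (B n) (B′ n))) (cong (_xor B′ n) (·≗𝟘⇒≗𝟘 A₀ A·[B+B′]≗𝟘 n))
  where
  A·[B+B′]≗𝟘 : A · (B ⊕ B′) ≗ 𝟘
  A·[B+B′]≗𝟘 m = trans (·-distribˡ-⊕ A B B′ m) (trans (cong₂ _xor_ (AB≗one m) (AB′≗one m)) (xor-same (one m)))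

Δ : Subset → Subset
Δ A = A ⊕ shift A

Δ-cong : A ≗ B → Δ A ≗ Δ B
Δ-cong eq = ⊕-cong eq (shift-cong eq)

Δ-shift : ∀ A → Δ (shift A) ≗ shift (Δ A)
Δ-shift A zero    = refl
Δ-shift A (suc n) = refl

Δ-·ˡ : ∀ A B → Δ A · B ≗ Δ (A · B)
Δ-·ˡ A B n = trans (·-distribʳ-⊕ A (shift A) B n) (cong ((A · B) n xor_) (shift-·ˡ A B n))

Δ-·ʳ : ∀ A B → A · Δ B ≗ Δ (A · B)
Δ-·ʳ A B n = trans (·-comm A (Δ B) n) (trans (Δ-·ˡ B A n) (Δ-cong {B · A} {A · B} (·-comm B A) n))

Δ-injective : Δ A ≗ Δ B → A ≗ B
Δ-injective {A} {B} eq zero    = trans (sym (xor-identityʳ (A 0))) (trans (eq 0) (xor-identityʳ (B 0)))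
Δ-injective {A} {B} eq (suc n) = begin
  A (suc n)                       ≡⟨ xor-cancelʳ (A (suc n)) (A n) ⟨
  (A (suc n) xor A n) xor A n     ≡⟨ cong₂ _xor_ (eq (suc n)) (Δ-injective {A} {B} eq n) ⟩
  (B (suc n) xor B n) xor B n     ≡⟨ xor-cancelʳ (B (suc n)) (B n) ⟩
  B (suc n)                       ∎
  where open ≡-Reasoning

dilate : Subset → Subset
dilate A zero          = A 0
dilate A (suc zero)    = false
dilate A (suc (suc n)) = dilate (tail A) n

frobenius : ∀ A → A · A ≗ dilate A
frobenius A zero          = ∧-idem (A 0)
frobenius A (suc zero)    = trans (cong ((A 0 ∧ A 1) xor_) (∧-comm (A 1) (A 0))) (xor-same (A 0 ∧ A 1))
frobenius A (suc (suc n)) = begin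
  (A 0 ∧ A (2 + n)) xor (tail A · A) (suc n)
    ≡⟨ cong ((A 0 ∧ A (2 + n)) xor_) (·-unfoldʳ (tail A) A n) ⟩
  (A 0 ∧ A (2 + n)) xor ((A (2 + n) ∧ A 0) xor (tail A · tail A) n)
    ≡⟨ cross-terms-cancel (A 0) (A (2 + n)) ((tail A · tail A) n) ⟩
  (tail A · tail A) n
    ≡⟨ frobenius (tail A) n ⟩
  dilate (tail A) n
    ∎
  where
  open ≡-Reasoning
  open xor-∧-Solver
  cross-terms-cancel : ∀ a b c → (a ∧ b) xor ((b ∧ a) xor c) ≡ c
  cross-terms-cancel = solve 3 (λ a b c → (a :* b) :+ ((b :* a) :+ c) := c) refl

dilate-double : ∀ A k → dilate A (2 * k) ≡ A k
dilate-double A zero    = refl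
dilate-double A (suc k) = trans (cong (dilate A) (*-suc 2 k)) (dilate-double (tail A) k)

dilate-double+1 : ∀ A k → dilate A (suc (2 * k)) ≡ false
dilate-double+1 A zero    = refl
dilate-double+1 A (suc k) = trans (cong (dilate A ∘ suc) (*-suc 2 k)) (dilate-double+1 (tail A) k)

-- Binary digits

isEven : ℕ → Bool
isEven n = n ℕ.% 2 ≡ᵇ 0

isEven-suc : ∀ n → isEven (suc n) ≡ not (isEven n)
isEven-suc zero          = refl
isEven-suc (suc zero)    = refl
isEven-suc (suc (suc n)) = isEven-suc n

isEven⇔2∣ : ∀ n → isEven n ≡ true ⇔ 2 ∣ n
isEven⇔2∣ n =
  ⇔.trans (⇔.sym T-≡) (⇔.trans (mk⇔ (≡ᵇ⇒≡ (n ℕ.% 2) 0) (≡⇒≡ᵇ (n ℕ.% 2) 0)) (m%n≡0⇔n∣m n 2))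

[2*k]%2≡0 : ∀ k → 2 * k ℕ.% 2 ≡ 0
[2*k]%2≡0 k = trans (cong (ℕ._% 2) (*-comm 2 k)) (m*n%n≡0 k 2)

[1+2*k]%2≡1 : ∀ k → suc (2 * k) ℕ.% 2 ≡ 1
[1+2*k]%2≡1 k = trans (cong (ℕ._% 2) (cong suc (*-comm 2 k))) ([m+kn]%n≡m%n 1 k 2)

[2*k]/2≡k : ∀ k → 2 * k ℕ./ 2 ≡ k
[2*k]/2≡k k = trans (cong (ℕ._/ 2) (*-comm 2 k)) (m*n/n≡m k 2)

[1+2*k]/2≡k : ∀ k → suc (2 * k) ℕ./ 2 ≡ k
[1+2*k]/2≡k k = trans (+-distrib-/ 1 (2 * k) remainders<2) ([2*k]/2≡k k)
  where
  remainders<2 : 1 ℕ.% 2 + 2 * k ℕ.% 2 < 2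
  remainders<2 = subst (λ r → 1 + r < 2) (sym ([2*k]%2≡0 k)) ≤-refl

[1+n]/2≤n : ∀ n → suc n ℕ./ 2 ≤ n
[1+n]/2≤n n = ≤-pred (m/n<m (suc n) 2 ≤-refl)

data Parity : ℕ → Set where
  even : ∀ k → Parity (2 * k)
  odd  : ∀ k → Parity (suc (2 * k))

parity : ∀ n → Parity n
parity zero = even 0
parity (suc n) with parity n
... | even k = odd k
... | odd k  = subst Parity (*-suc 2 k) (even (suc k))

binary-induction : (P : ℕ → Set) → P 0 → (∀ k → P (suc k) → P (2 * suc k)) → (∀ k → P k → P (suc (2 * k))) →
                   ∀ n → P n
binary-induction P P0 P-double P-double+1 = <-rec P step
  where
  step : ∀ n → (∀ {m} → m < n → P m) → P n
  step n rec with parity n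
  ... | even zero    = P0
  ... | even (suc k) = P-double k (rec (subst (suc k <_) (*-comm (suc k) 2) (m<m*n (suc k) 2 ≤-refl)))
  ... | odd k        = P-double+1 k (rec (s≤s (m≤n*m k 2)))

onesF-fuel : ∀ f g n → n ≤ f → n ≤ g → onesF f n ≡ onesF g n
onesF-fuel zero    zero    n       _   _   = refl
onesF-fuel zero    (suc g) zero    _   _   = onesF-fuel zero g 0 z≤n z≤n
onesF-fuel (suc f) zero    zero    _   _   = onesF-fuel f zero 0 z≤n z≤n
onesF-fuel (suc f) (suc g) n       n≤f n≤g = cong (λ x → n ℕ.% 2 + x) (onesF-fuel f g (n ℕ./ 2) (half≤ n≤f) (half≤ n≤g))
  where
  half≤ : ∀ {n f} → n ≤ suc f → n ℕ./ 2 ≤ f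
  half≤ {zero}  _   = z≤n
  half≤ {suc n} n≤f = ≤-trans ([1+n]/2≤n n) (≤-pred n≤f)

ones-step : ∀ n → ones n ≡ n ℕ.% 2 + ones (n ℕ./ 2)
ones-step zero    = refl
ones-step (suc n) = cong (λ x → suc n ℕ.% 2 + x) (onesF-fuel n (suc n ℕ./ 2) (suc n ℕ./ 2) ([1+n]/2≤n n) ≤-refl)

ones-double : ∀ k → ones (2 * k) ≡ ones k
ones-double k = trans (ones-step (2 * k)) (cong₂ _+_ ([2*k]%2≡0 k) (cong ones ([2*k]/2≡k k)))

ones-double+1 : ∀ k → ones (suc (2 * k)) ≡ suc (ones k)
ones-double+1 k = trans (ones-step (suc (2 * k))) (cong₂ _+_ ([1+2*k]%2≡1 k) (cong ones ([1+2*k]/2≡k k)))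

ones≤ : ∀ k → ones k ≤ k
ones≤ = binary-induction _ z≤n
  (λ k IH → subst (_≤ 2 * suc k) (sym (ones-double (suc k))) (≤-trans IH (m≤n*m (suc k) 2)))
  (λ k IH → subst (_≤ suc (2 * k)) (sym (ones-double+1 k)) (s≤s (≤-trans IH (m≤n*m k 2))))

ones²≤4k : ∀ k → ones k * ones k ≤ 4 * k
ones²≤4k = binary-induction _ z≤n even-step odd-step
  where
  open ≤-Reasoning
  even-step : ∀ k → ones (suc k) * ones (suc k) ≤ 4 * suc k → ones (2 * suc k) * ones (2 * suc k) ≤ 4 * (2 * suc k)
  even-step k IH = subst (λ b → b * b ≤ 4 * (2 * suc k)) (sym (ones-double (suc k)))
                         (≤-trans IH (*-monoʳ-≤ 4 (m≤n*m (suc k) 2)))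
  odd-step : ∀ k → ones k * ones k ≤ 4 * k → ones (suc (2 * k)) * ones (suc (2 * k)) ≤ 4 * suc (2 * k)
  odd-step k IH = subst (λ b → b * b ≤ 4 * suc (2 * k)) (sym (ones-double+1 k)) (begin
    suc (ones k) * suc (ones k)      ≡⟨ square-suc (ones k) ⟩
    ones k * ones k + 2 * ones k + 1 ≤⟨ +-monoˡ-≤ 1 (+-mono-≤ IH (*-monoʳ-≤ 2 (ones≤ k))) ⟩
    4 * k + 2 * k + 1                ≤⟨ m≤m+n (4 * k + 2 * k + 1) (2 * k + 3) ⟩
    4 * k + 2 * k + 1 + (2 * k + 3)  ≡⟨ regroup k ⟩
    4 * suc (2 * k)                  ∎)
    where
    square-suc : ∀ b → suc b * suc b ≡ b * b + 2 * b + 1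
    square-suc = solve-∀
    regroup : ∀ k → 4 * k + 2 * k + 1 + (2 * k + 3) ≡ 4 * suc (2 * k)
    regroup = solve-∀

trailingZerosF-fuel : ∀ f g n → n ≤ f → n ≤ g → trailingZerosF f n ≡ trailingZerosF g n
trailingZerosF-fuel zero    zero    n       _   _   = refl
trailingZerosF-fuel zero    (suc g) zero    _   _   = refl
trailingZerosF-fuel (suc f) zero    zero    _   _   = refl
trailingZerosF-fuel (suc f) (suc g) zero    _   _   = refl
trailingZerosF-fuel (suc f) (suc g) (suc n) n<f n<g =
  cong (λ t → if isEven (suc n) then suc t else 0)
       (trailingZerosF-fuel f g (suc n ℕ./ 2) (≤-trans ([1+n]/2≤n n) (≤-pred n<f)) (≤-trans ([1+n]/2≤n n) (≤-pred n<g)))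

trailingZeros-step : ∀ n .{{_ : ℕ.NonZero n}} →
                     trailingZeros n ≡ (if isEven n then suc (trailingZeros (n ℕ./ 2)) else 0)
trailingZeros-step (suc n) =
  cong (λ t → if isEven (suc n) then suc t else 0) (trailingZerosF-fuel n (suc n ℕ./ 2) (suc n ℕ./ 2) ([1+n]/2≤n n) ≤-refl)

trailingZeros-double+1 : ∀ k → trailingZeros (suc (2 * k)) ≡ 0
trailingZeros-double+1 k =
  trans (trailingZeros-step (suc (2 * k)))
        (cong (λ r → if r ≡ᵇ 0 then suc (trailingZeros (suc (2 * k) ℕ./ 2)) else 0) ([1+2*k]%2≡1 k))

trailingZeros-double : ∀ k → trailingZeros (2 * suc k) ≡ suc (trailingZeros (suc k))
trailingZeros-double k = begin
  trailingZeros (2 * suc k)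
    ≡⟨ trailingZeros-step (2 * suc k) ⟩
  (if isEven (2 * suc k) then suc (trailingZeros (2 * suc k ℕ./ 2)) else 0)
    ≡⟨ cong (λ r → if r ≡ᵇ 0 then suc (trailingZeros (2 * suc k ℕ./ 2)) else 0) ([2*k]%2≡0 (suc k)) ⟩
  suc (trailingZeros (2 * suc k ℕ./ 2))
    ≡⟨ cong (suc ∘ trailingZeros) ([2*k]/2≡k (suc k)) ⟩
  suc (trailingZeros (suc k))
    ∎
  where open ≡-Reasoning

-- The reciprocal of T

T-double : ∀ k → T (2 * k) ≡ T k
T-double k = cong isEven (ones-double k)

T-double+1 : ∀ k → T (suc (2 * k)) ≡ not (T k)
T-double+1 k = trans (cong isEven (ones-double+1 k)) (isEven-suc (ones k))

EvenTZ : Subset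
EvenTZ zero    = false
EvenTZ (suc n) = isEven (trailingZeros (suc n))

EvenTZ⇔ : ∀ k → EvenTZ k ≡ true ⇔ (1 ≤ k × 2 ∣ trailingZeros k)
EvenTZ⇔ zero    = mk⇔ (λ ()) (λ ())
EvenTZ⇔ (suc n) = mk⇔ (λ e → s≤s z≤n , Equivalence.to (isEven⇔2∣ _) e) (λ (_ , d) → Equivalence.from (isEven⇔2∣ _) d)

EvenTZ-double+1 : ∀ k → EvenTZ (suc (2 * k)) ≡ true
EvenTZ-double+1 k = cong isEven (trailingZeros-double+1 k)

EvenTZ-double : ∀ k → EvenTZ (2 * suc k) ≡ not (EvenTZ (suc k))
EvenTZ-double k = trans (cong isEven (trailingZeros-double k)) (isEven-suc (trailingZeros (suc k)))

T-step : ∀ n → T (suc n) xor T n ≡ EvenTZ (suc n)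
T-step = binary-induction _ (from-even 0) (λ k _ → from-even (suc k)) from-odd
  where
  open ≡-Reasoning
  from-even : ∀ k → T (suc (2 * k)) xor T (2 * k) ≡ EvenTZ (suc (2 * k))
  from-even k = begin
    T (suc (2 * k)) xor T (2 * k)  ≡⟨ cong₂ _xor_ (T-double+1 k) (T-double k) ⟩
    not (T k) xor T k              ≡⟨ xor-inverseˡ (T k) ⟩
    true                           ≡⟨ EvenTZ-double+1 k ⟨
    EvenTZ (suc (2 * k))           ∎
  from-odd : ∀ k → T (suc k) xor T k ≡ EvenTZ (suc k) → T (suc (suc (2 * k))) xor T (suc (2 * k)) ≡ EvenTZ (suc (suc (2 * k)))
  from-odd k IH = begin
    T (2 + 2 * k) xor T (suc (2 * k))  ≡⟨ cong₂ _xor_ (trans (cong T (sym (*-suc 2 k))) (T-double (suc k))) (T-double+1 k) ⟩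
    T (suc k) xor not (T k)            ≡⟨ not-distribʳ-xor (T (suc k)) (T k) ⟨
    not (T (suc k) xor T k)            ≡⟨ cong not IH ⟩
    not (EvenTZ (suc k))               ≡⟨ EvenTZ-double k ⟨
    EvenTZ (2 * suc k)                 ≡⟨ cong EvenTZ (*-suc 2 k) ⟩
    EvenTZ (2 + 2 * k)                 ∎

Δ-T : Δ T ≗ one ⊕ EvenTZ
Δ-T zero    = refl
Δ-T (suc n) = T-step n

ℕ⁺ : Subset
ℕ⁺ zero    = false
ℕ⁺ (suc n) = true

Δ-ℕ⁺ : Δ ℕ⁺ ≗ shift one
Δ-ℕ⁺ zero          = refl
Δ-ℕ⁺ (suc zero)    = refl
Δ-ℕ⁺ (suc (suc n)) = refl

EvenTZ+EvenTZ² : EvenTZ ⊕ EvenTZ · EvenTZ ≗ ℕ⁺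
EvenTZ+EvenTZ² n with parity n
... | even zero    = refl
... | even (suc k) = begin
  EvenTZ (2 * suc k) xor (EvenTZ · EvenTZ) (2 * suc k)  ≡⟨ cong₂ _xor_ (EvenTZ-double k) (frobenius EvenTZ (2 * suc k)) ⟩
  not (EvenTZ (suc k)) xor dilate EvenTZ (2 * suc k)    ≡⟨ cong (not (EvenTZ (suc k)) xor_) (dilate-double EvenTZ (suc k)) ⟩
  not (EvenTZ (suc k)) xor EvenTZ (suc k)               ≡⟨ xor-inverseˡ (EvenTZ (suc k)) ⟩
  true                                                  ∎
  where open ≡-Reasoning
... | odd k = cong₂ _xor_ (EvenTZ-double+1 k) (trans (frobenius EvenTZ (suc (2 * k))) (dilate-double+1 EvenTZ k))

-- The candidate reciprocal (1 + q)² · EvenTZ / q; the junk value 0 ∸ 1 = 0 is harmless as EvenTZ 0 = false.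
Tbar : Subset
Tbar n = EvenTZ (suc n) xor EvenTZ (n ∸ 1)

shift-Tbar : shift Tbar ≗ Δ (Δ EvenTZ)
shift-Tbar zero          = refl
shift-Tbar (suc zero)    = refl
shift-Tbar (suc (suc n)) = solve 3 (λ a b c → a :+ c := (a :+ b) :+ (b :+ c)) refl (EvenTZ (2 + n)) (EvenTZ (suc n)) (EvenTZ n)
  where open xor-∧-Solver

T·Tbar≗one : T · Tbar ≗ one
T·Tbar≗one = Δ-injective {T · Tbar} {one} (λ n → shifted (suc n))
  where
  open import Relation.Binary.Reasoning.Setoid (ℕ →-setoid Bool)
  shifted : shift (Δ (T · Tbar)) ≗ shift (Δ one)
  shifted = begin
    shift (Δ (T · Tbar))               ≈⟨ shift-cong (Δ-·ˡ T Tbar) ⟨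
    shift (Δ T · Tbar)                 ≈⟨ shift-·ʳ (Δ T) Tbar ⟨
    Δ T · shift Tbar                   ≈⟨ ·-cong Δ-T shift-Tbar ⟩
    (one ⊕ EvenTZ) · Δ (Δ EvenTZ)      ≈⟨ Δ-·ʳ (one ⊕ EvenTZ) (Δ EvenTZ) ⟩
    Δ ((one ⊕ EvenTZ) · Δ EvenTZ)      ≈⟨ Δ-cong (Δ-·ʳ (one ⊕ EvenTZ) EvenTZ) ⟩
    Δ (Δ ((one ⊕ EvenTZ) · EvenTZ))    ≈⟨ Δ-cong (Δ-cong (λ n → trans (·-distribʳ-⊕ one EvenTZ EvenTZ n)
                                                                (cong (_xor (EvenTZ · EvenTZ) n) (·-identityˡ EvenTZ n)))) ⟩
    Δ (Δ (EvenTZ ⊕ EvenTZ · EvenTZ))   ≈⟨ Δ-cong (Δ-cong EvenTZ+EvenTZ²) ⟩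
    Δ (Δ ℕ⁺)                           ≈⟨ Δ-cong Δ-ℕ⁺ ⟩
    Δ (shift one)                      ≈⟨ Δ-shift one ⟩
    shift (Δ one)                      ∎

T-reciprocal-Tbar : IsReciprocal T Tbar
T-reciprocal-Tbar n = trans (conv≗· T Tbar n) (T·Tbar≗one n)

T-reciprocal-unique : ∀ B → IsReciprocal T B → B ≗ Tbar
T-reciprocal-unique B reciprocal = reciprocal-unique {T} refl (λ n → trans (sym (conv≗· T B n)) (reciprocal n)) T·Tbar≗one

data Mod4 : ℕ → Set where
  rem0 : ∀ k → Mod4 (4 * k)
  rem1 : ∀ k → Mod4 (1 + 4 * k)
  rem2 : ∀ k → Mod4 (2 + 4 * k)
  rem3 : ∀ k → Mod4 (3 + 4 * k)

mod4 : ∀ n → Mod4 n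
mod4 zero = rem0 0
mod4 (suc n) with mod4 n
... | rem0 k = rem1 k
... | rem1 k = rem2 k
... | rem2 k = rem3 k
... | rem3 k = subst Mod4 (*-suc 4 k) (rem0 (suc k))

EvenTZ-4k : ∀ k → EvenTZ (4 * k) ≡ EvenTZ k
EvenTZ-4k zero    = refl
EvenTZ-4k (suc k) = begin
  EvenTZ (4 * suc k)                ≡⟨ cong EvenTZ (4[1+k]≡2[2+2k] k) ⟩
  EvenTZ (2 * suc (suc (2 * k)))    ≡⟨ EvenTZ-double (suc (2 * k)) ⟩
  not (EvenTZ (suc (suc (2 * k))))  ≡⟨ cong (not ∘ EvenTZ) (*-suc 2 k) ⟨
  not (EvenTZ (2 * suc k))          ≡⟨ cong not (EvenTZ-double k) ⟩
  not (not (EvenTZ (suc k)))        ≡⟨ not-involutive (EvenTZ (suc k)) ⟩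
  EvenTZ (suc k)                    ∎
  where
  open ≡-Reasoning
  4[1+k]≡2[2+2k] : ∀ k → 4 * suc k ≡ 2 * suc (suc (2 * k))
  4[1+k]≡2[2+2k] = solve-∀

EvenTZ-1+4k : ∀ k → EvenTZ (1 + 4 * k) ≡ true
EvenTZ-1+4k k = trans (cong (EvenTZ ∘ suc) (*-assoc 2 2 k)) (EvenTZ-double+1 (2 * k))

EvenTZ-2+4k : ∀ k → EvenTZ (2 + 4 * k) ≡ false
EvenTZ-2+4k k = begin
  EvenTZ (2 + 4 * k)          ≡⟨ cong EvenTZ (2+4k≡2[1+2k] k) ⟩
  EvenTZ (2 * suc (2 * k))    ≡⟨ EvenTZ-double (2 * k) ⟩
  not (EvenTZ (suc (2 * k)))  ≡⟨ cong not (EvenTZ-double+1 k) ⟩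
  false                       ∎
  where
  open ≡-Reasoning
  2+4k≡2[1+2k] : ∀ k → 2 + 4 * k ≡ 2 * suc (2 * k)
  2+4k≡2[1+2k] = solve-∀

EvenTZ-3+4k : ∀ k → EvenTZ (3 + 4 * k) ≡ true
EvenTZ-3+4k k = trans (cong EvenTZ (3+4k≡1+2[1+2k] k)) (EvenTZ-double+1 (suc (2 * k)))
  where
  3+4k≡1+2[1+2k] : ∀ k → 3 + 4 * k ≡ suc (2 * suc (2 * k))
  3+4k≡1+2[1+2k] = solve-∀

Tbar-4[1+k] : ∀ k → Tbar (4 * suc k) ≡ false
Tbar-4[1+k] k = trans (cong Tbar (*-suc 4 k))
  (cong₂ _xor_ (trans (cong (EvenTZ ∘ suc) (sym (*-suc 4 k))) (EvenTZ-1+4k (suc k))) (EvenTZ-3+4k k))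

Tbar-1+4k : ∀ k → Tbar (1 + 4 * k) ≡ EvenTZ k
Tbar-1+4k k = cong₂ _xor_ (EvenTZ-2+4k k) (EvenTZ-4k k)

Tbar-2+4k : ∀ k → Tbar (2 + 4 * k) ≡ false
Tbar-2+4k k = cong₂ _xor_ (EvenTZ-3+4k k) (EvenTZ-1+4k k)

Tbar-3+4k : ∀ k → Tbar (3 + 4 * k) ≡ EvenTZ (suc k)
Tbar-3+4k k = trans (cong₂ _xor_ (trans (cong EvenTZ (sym (*-suc 4 k))) (EvenTZ-4k (suc k))) (EvenTZ-2+4k k))
                    (xor-identityʳ (EvenTZ (suc k)))

Tbar⇔InTbar : ∀ n → Tbar n ≡ true ⇔ InTbar n
Tbar⇔InTbar n = mk⇔ (to (mod4 n)) from
  where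
  to : ∀ {n} → Mod4 n → Tbar n ≡ true → InTbar n
  to (rem0 zero)    _ = inj₁ refl
  to (rem0 (suc k)) e with () ← trans (sym (Tbar-4[1+k] k)) e
  to (rem1 k)       e = inj₂ (k , proj₁ tz , proj₂ tz , inj₁ (+-comm 1 (4 * k)))
    where
    tz : 1 ≤ k × 2 ∣ trailingZeros k
    tz = Equivalence.to (EvenTZ⇔ k) (trans (sym (Tbar-1+4k k)) e)
  to (rem2 k)       e with () ← trans (sym (Tbar-2+4k k)) e
  to (rem3 k)       e = inj₂ (suc k , proj₁ tz , proj₂ tz , inj₂ (trans (+-comm (3 + 4 * k) 1) (sym (*-suc 4 k))))
    where
    tz : 1 ≤ suc k × 2 ∣ trailingZeros (suc k)
    tz = Equivalence.to (EvenTZ⇔ (suc k)) (trans (sym (Tbar-3+4k k)) e)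
  from : InTbar n → Tbar n ≡ true
  from (inj₁ refl) = refl
  from (inj₂ (k , 1≤k , 2∣tz , inj₁ refl)) =
    trans (cong Tbar (+-comm (4 * k) 1)) (trans (Tbar-1+4k k) (Equivalence.from (EvenTZ⇔ k) (1≤k , 2∣tz)))
  from (inj₂ (suc k , 1≤k , 2∣tz , inj₂ n+1≡4[1+k])) =
    trans (cong Tbar n≡3+4k) (trans (Tbar-3+4k k) (Equivalence.from (EvenTZ⇔ (suc k)) (1≤k , 2∣tz)))
    where
    n≡3+4k : n ≡ 3 + 4 * k
    n≡3+4k = suc-injective (trans (+-comm 1 n) (trans n+1≡4[1+k] (*-suc 4 k)))

-- Density

indicator : Bool → ℕ
indicator b = if b then 1 else 0

indicator≤1 : ∀ b → indicator b ≤ 1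
indicator≤1 false = z≤n
indicator≤1 true  = ≤-refl

indicator-not : ∀ b → indicator (not b) + indicator b ≡ 1
indicator-not false = refl
indicator-not true  = refl

count-suc : ∀ B n → count B (suc n) ≡ count B n + indicator (B (suc n))
count-suc B n = begin
  count B (suc n)                                                 ≡⟨ cong (sum ∘ map f) (applyUpTo-∷ʳ (λ i → i) (suc n)) ⟨
  sum (map f (upTo (suc n) ++ [ suc n ]))                         ≡⟨ cong sum (map-++ f (upTo (suc n)) [ suc n ]) ⟩
  sum (map f (upTo (suc n)) ++ [ f (suc n) ])                     ≡⟨ sum-++ (map f (upTo (suc n))) [ f (suc n) ] ⟩
  count B n + (indicator (B (suc n)) + 0)                         ≡⟨ cong (λ x → count B n + x) (+-identityʳ _) ⟩
  count B n + indicator (B (suc n))                               ∎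
  where
  open ≡-Reasoning
  f : ℕ → ℕ
  f i = indicator (B i)

count-cong : B ≗ B′ → ∀ n → count B n ≡ count B′ n
count-cong eq n = cong (foldr _+_ 0) (map-cong (λ i → cong indicator (eq i)) (upTo (suc n)))

count-d+n-bounds : ∀ B d n → count B n ≤ count B (d + n) × count B (d + n) ≤ count B n + d
count-d+n-bounds B zero    n = ≤-refl , ≤-reflexive (sym (+-identityʳ (count B n)))
count-d+n-bounds B (suc d) n = ≤-trans lower (≤-trans (m≤m+n _ _) (≤-reflexive (sym (count-suc B (d + n))))) , (begin
  count B (suc d + n)                                 ≡⟨ count-suc B (d + n) ⟩
  count B (d + n) + indicator (B (suc (d + n)))       ≤⟨ +-mono-≤ upper (indicator≤1 _) ⟩
  count B n + d + 1                                   ≡⟨ +-assoc (count B n) d 1 ⟩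
  count B n + (d + 1)                                 ≡⟨ cong (λ x → count B n + x) (+-comm d 1) ⟩
  count B n + suc d                                   ∎)
  where
  open ≤-Reasoning
  lower : count B n ≤ count B (d + n)
  lower = proj₁ (count-d+n-bounds B d n)
  upper : count B (d + n) ≤ count B n + d
  upper = proj₂ (count-d+n-bounds B d n)

count-lipschitz-≤ : ∀ B {m n} → m ≤ n → ∣ count B m - count B n ∣ ≤ ∣ m - n ∣
count-lipschitz-≤ B {m} {n} m≤n = begin
  ∣ count B m - count B n ∣              ≡⟨ cong (λ k → ∣ count B m - count B k ∣) (m∸n+n≡m m≤n) ⟨
  ∣ count B m - count B (n ∸ m + m) ∣    ≡⟨ m≤n⇒∣m-n∣≡n∸m (proj₁ (count-d+n-bounds B (n ∸ m) m)) ⟩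
  count B (n ∸ m + m) ∸ count B m        ≤⟨ m≤n+o⇒m∸n≤o _ _ (proj₂ (count-d+n-bounds B (n ∸ m) m)) ⟩
  n ∸ m                                  ≡⟨ m≤n⇒∣m-n∣≡n∸m m≤n ⟨
  ∣ m - n ∣                              ∎
  where open ≤-Reasoning

count-lipschitz : ∀ B m n → ∣ count B m - count B n ∣ ≤ ∣ m - n ∣
count-lipschitz B m n with ≤-total m n
... | inj₁ m≤n = count-lipschitz-≤ B m≤n
... | inj₂ n≤m = subst₂ _≤_ (∣-∣-comm (count B n) (count B m)) (∣-∣-comm n m) (count-lipschitz-≤ B n≤m)

count-4+ : ∀ B n → count B (4 + n) ≡
  count B n + indicator (B (1 + n)) + indicator (B (2 + n)) + indicator (B (3 + n)) + indicator (B (4 + n))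
count-4+ B n = begin
  count B (4 + n)                                    ≡⟨ count-suc B (3 + n) ⟩
  count B (3 + n) + ι 4                              ≡⟨ cong (λ c → c + ι 4) (count-suc B (2 + n)) ⟩
  count B (2 + n) + ι 3 + ι 4                        ≡⟨ cong (λ c → c + ι 3 + ι 4) (count-suc B (1 + n)) ⟩
  count B (1 + n) + ι 2 + ι 3 + ι 4                  ≡⟨ cong (λ c → c + ι 2 + ι 3 + ι 4) (count-suc B n) ⟩
  count B n + ι 1 + ι 2 + ι 3 + ι 4                  ∎
  where
  open ≡-Reasoning
  ι : ℕ → ℕ
  ι i = indicator (B (i + n))

∣r+x-x∣≡r : ∀ r x → ∣ r + x - x ∣ ≡ r
∣r+x-x∣≡r r x = trans (∣-∣-comm (r + x) x) (trans (cong (∣ x -_∣) (+-comm r x)) (∣m-m+n∣≡n x r))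

∣a-c∣≡∣d-b∣ : ∀ a b c d → a + b ≡ c + d → ∣ a - c ∣ ≡ ∣ d - b ∣
∣a-c∣≡∣d-b∣ a b c d a+b≡c+d = begin
  ∣ a - c ∣               ≡⟨ ∣m+n-m+o∣≡∣n-o∣ b a c ⟨
  ∣ b + a - b + c ∣       ≡⟨ cong₂ ∣_-_∣ (trans (+-comm b a) a+b≡c+d) (+-comm b c) ⟩
  ∣ c + d - c + b ∣       ≡⟨ ∣m+n-m+o∣≡∣n-o∣ c d b ⟩
  ∣ d - b ∣               ∎
  where open ≡-Reasoning

∣1+a-b∣≤1+∣a-b∣ : ∀ a b → ∣ suc a - b ∣ ≤ suc ∣ a - b ∣
∣1+a-b∣≤1+∣a-b∣ a b = begin
  ∣ suc a - b ∣               ≤⟨ ∣-∣-triangle (suc a) a b ⟩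
  ∣ suc a - a ∣ + ∣ a - b ∣   ≡⟨ cong (_+ ∣ a - b ∣) (∣r+x-x∣≡r 1 a) ⟩
  1 + ∣ a - b ∣               ∎
  where open ≤-Reasoning

count-EvenTZ-double+1 : ∀ k → count EvenTZ (suc (2 * k)) ≡ suc (count EvenTZ (2 * k))
count-EvenTZ-double+1 k =
  trans (count-suc EvenTZ (2 * k)) (trans (cong (λ b → count EvenTZ (2 * k) + indicator b) (EvenTZ-double+1 k))
                                          (+-comm (count EvenTZ (2 * k)) 1))

count-EvenTZ-double : ∀ k → count EvenTZ (2 * k) + count EvenTZ k ≡ 2 * k
count-EvenTZ-double zero    = refl
count-EvenTZ-double (suc k) = begin
  count EvenTZ (2 * suc k) + count EvenTZ (suc k)
    ≡⟨ cong₂ _+_ double-step (count-suc EvenTZ k) ⟩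
  suc (count EvenTZ (2 * k)) + indicator (not b) + (count EvenTZ k + indicator b)
    ≡⟨ rearrange (count EvenTZ (2 * k)) (count EvenTZ k) (indicator (not b)) (indicator b) ⟩
  suc ((count EvenTZ (2 * k) + count EvenTZ k) + (indicator (not b) + indicator b))
    ≡⟨ cong₂ (λ x y → suc (x + y)) (count-EvenTZ-double k) (indicator-not b) ⟩
  suc (2 * k + 1)
    ≡⟨ +-comm (suc (2 * k)) 1 ⟩
  2 + 2 * k
    ≡⟨ *-suc 2 k ⟨
  2 * suc k
    ∎
  where
  open ≡-Reasoning
  b : Bool
  b = EvenTZ (suc k)
  double-step : count EvenTZ (2 * suc k) ≡ suc (count EvenTZ (2 * k)) + indicator (not b)
  double-step = trans (cong (count EvenTZ) (*-suc 2 k))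
    (trans (count-suc EvenTZ (suc (2 * k)))
           (cong₂ _+_ (count-EvenTZ-double+1 k) (cong indicator (trans (cong EvenTZ (sym (*-suc 2 k))) (EvenTZ-double k)))))
  rearrange : ∀ a a′ x x′ → (suc a + x) + (a′ + x′) ≡ suc ((a + a′) + (x + x′))
  rearrange = solve-∀

count-EvenTZ-error : ∀ k → ∣ 3 * count EvenTZ k - 2 * k ∣ ≤ ones k
count-EvenTZ-error = binary-induction _ z≤n even-step odd-step
  where
  open ≤-Reasoning
  error-double : ∀ m → ∣ 3 * count EvenTZ (2 * m) - 2 * (2 * m) ∣ ≡ ∣ 3 * count EvenTZ m - 2 * m ∣
  error-double m = trans (∣a-c∣≡∣d-b∣ (3 * count EvenTZ (2 * m)) (3 * count EvenTZ m) (2 * (2 * m)) (2 * m) sums)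
                         (∣-∣-comm (2 * m) (3 * count EvenTZ m))
    where
    sums : 3 * count EvenTZ (2 * m) + 3 * count EvenTZ m ≡ 2 * (2 * m) + 2 * m
    sums = trans (sym (*-distribˡ-+ 3 (count EvenTZ (2 * m)) _))
                 (trans (cong (3 *_) (count-EvenTZ-double m)) (3[2m]≡2[2m]+2m m))
      where
      3[2m]≡2[2m]+2m : ∀ m → 3 * (2 * m) ≡ 2 * (2 * m) + 2 * m
      3[2m]≡2[2m]+2m = solve-∀
  even-step : ∀ k → ∣ 3 * count EvenTZ (suc k) - 2 * suc k ∣ ≤ ones (suc k) →
              ∣ 3 * count EvenTZ (2 * suc k) - 2 * (2 * suc k) ∣ ≤ ones (2 * suc k)
  even-step k IH = subst₂ _≤_ (sym (error-double (suc k))) (sym (ones-double (suc k))) IH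
  odd-step : ∀ k → ∣ 3 * count EvenTZ k - 2 * k ∣ ≤ ones k →
             ∣ 3 * count EvenTZ (suc (2 * k)) - 2 * suc (2 * k) ∣ ≤ ones (suc (2 * k))
  odd-step k IH = begin
    ∣ 3 * count EvenTZ (suc (2 * k)) - 2 * suc (2 * k) ∣
      ≡⟨ cong₂ ∣_-_∣ (trans (cong (3 *_) (count-EvenTZ-double+1 k)) (*-suc 3 _)) (*-suc 2 (2 * k)) ⟩
    ∣ 3 + 3 * count EvenTZ (2 * k) - 2 + 2 * (2 * k) ∣
      ≤⟨ ∣1+a-b∣≤1+∣a-b∣ (3 * count EvenTZ (2 * k)) (2 * (2 * k)) ⟩
    suc ∣ 3 * count EvenTZ (2 * k) - 2 * (2 * k) ∣
      ≡⟨ cong suc (error-double k) ⟩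
    suc ∣ 3 * count EvenTZ k - 2 * k ∣
      ≤⟨ s≤s IH ⟩
    suc (ones k)
      ≡⟨ ones-double+1 k ⟨
    ones (suc (2 * k))
      ∎

count-Tbar-1+4K : ∀ K → count Tbar (1 + 4 * K) ≡ suc (2 * count EvenTZ K)
count-Tbar-1+4K zero    = refl
count-Tbar-1+4K (suc K) = begin
  count Tbar (1 + 4 * suc K)
    ≡⟨ cong (count Tbar ∘ suc) (*-suc 4 K) ⟩
  count Tbar (4 + (1 + 4 * K))
    ≡⟨ count-4+ Tbar (1 + 4 * K) ⟩
  count Tbar (1 + 4 * K) + ι (Tbar (2 + 4 * K)) + ι (Tbar (3 + 4 * K)) + ι (Tbar (4 + 4 * K)) + ι (Tbar (5 + 4 * K))
    ≡⟨ cong₂ _+_ (cong₂ _+_ (cong₂ _+_ (cong₂ _+_ (count-Tbar-1+4K K) (cong ι (Tbar-2+4k K)))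
                                       (cong ι (Tbar-3+4k K)))
                            (cong ι (trans (cong Tbar (sym (*-suc 4 K))) (Tbar-4[1+k] K))))
                 (cong ι (trans (cong (Tbar ∘ suc) (sym (*-suc 4 K))) (Tbar-1+4k (suc K)))) ⟩
  suc (2 * count EvenTZ K) + 0 + ι (EvenTZ (suc K)) + 0 + ι (EvenTZ (suc K))
    ≡⟨ collect (count EvenTZ K) (ι (EvenTZ (suc K))) ⟩
  suc (2 * (count EvenTZ K + ι (EvenTZ (suc K))))
    ≡⟨ cong (suc ∘ (2 *_)) (count-suc EvenTZ K) ⟨
  suc (2 * count EvenTZ (suc K))
    ∎
  where
  open ≡-Reasoning
  ι : Bool → ℕ
  ι = indicator
  collect : ∀ g e → suc (2 * g) + 0 + e + 0 + e ≡ suc (2 * (g + e))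
  collect = solve-∀

near-1+4K : ∀ n → ∃ λ K → 4 * K ≤ n × ∣ n - (1 + 4 * K) ∣ ≤ 2
near-1+4K n with mod4 n
... | rem0 k = k , ≤-refl , ≤-trans (≤-reflexive (trans (∣-∣-comm (4 * k) (1 + 4 * k)) (∣r+x-x∣≡r 1 (4 * k)))) (s≤s z≤n)
... | rem1 k = k , m≤n+m (4 * k) 1 , ≤-trans (≤-reflexive (∣r+x-x∣≡r 0 (4 * k))) z≤n
... | rem2 k = k , m≤n+m (4 * k) 2 , ≤-trans (≤-reflexive (∣r+x-x∣≡r 1 (4 * k))) (s≤s z≤n)
... | rem3 k = k , m≤n+m (4 * k) 3 , ≤-reflexive (∣r+x-x∣≡r 2 (4 * k))

count-Tbar-error : ∀ n → ∃ λ K → 4 * K ≤ n × ∣ 3 * count Tbar n - suc n ∣ ≤ 2 * ones K + 9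
count-Tbar-error n with near-1+4K n
... | K , 4K≤n , ∣n-m∣≤2 = K , 4K≤n , (begin
  ∣ 3 * c n - suc n ∣                                     ≤⟨ ∣-∣-triangle (3 * c n) (3 * c m) (suc n) ⟩
  ∣ 3 * c n - 3 * c m ∣ + ∣ 3 * c m - suc n ∣
    ≤⟨ +-monoʳ-≤ ∣ 3 * c n - 3 * c m ∣ (∣-∣-triangle (3 * c m) (suc m) (suc n)) ⟩
  ∣ 3 * c n - 3 * c m ∣ + (∣ 3 * c m - suc m ∣ + ∣ m - n ∣)
    ≡⟨ cong₂ (λ x y → x + (∣ 3 * c m - suc m ∣ + y)) (sym (*-distribˡ-∣-∣ 3 (c n) (c m))) (∣-∣-comm m n) ⟩
  3 * ∣ c n - c m ∣ + (∣ 3 * c m - suc m ∣ + ∣ n - m ∣)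
    ≤⟨ +-mono-≤ (*-monoʳ-≤ 3 (≤-trans (count-lipschitz Tbar n m) ∣n-m∣≤2)) (+-mono-≤ centre ∣n-m∣≤2) ⟩
  6 + (suc (2 * ones K) + 2)                              ≡⟨ regroup (ones K) ⟩
  2 * ones K + 9                                          ∎)
  where
  open ≤-Reasoning
  c : ℕ → ℕ
  c = count Tbar
  m : ℕ
  m = 1 + 4 * K
  regroup : ∀ b → 6 + (suc (2 * b) + 2) ≡ 2 * b + 9
  regroup = solve-∀
  g : ℕ
  g = count EvenTZ K
  centre : ∣ 3 * c m - suc m ∣ ≤ suc (2 * ones K)
  centre = begin
    ∣ 3 * c m - suc m ∣                          ≡⟨ cong₂ ∣_-_∣ (trans (cong (3 *_) (count-Tbar-1+4K K)) (3[1+2g] g))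
                                                                (2+4K≡2+2[2K] K) ⟩
    ∣ 3 + 2 * (3 * g) - 2 + 2 * (2 * K) ∣        ≤⟨ ∣1+a-b∣≤1+∣a-b∣ (2 * (3 * g)) (2 * (2 * K)) ⟩
    suc ∣ 2 * (3 * g) - 2 * (2 * K) ∣            ≡⟨ cong suc (*-distribˡ-∣-∣ 2 (3 * g) (2 * K)) ⟨
    suc (2 * ∣ 3 * g - 2 * K ∣)                  ≤⟨ s≤s (*-monoʳ-≤ 2 (count-EvenTZ-error K)) ⟩
    suc (2 * ones K)                             ∎
    where
    3[1+2g] : ∀ g → 3 * suc (2 * g) ≡ 3 + 2 * (3 * g)
    3[1+2g] = solve-∀
    2+4K≡2+2[2K] : ∀ K → suc (1 + 4 * K) ≡ 2 + 2 * (2 * K)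
    2+4K≡2+2[2K] = solve-∀

s*[2β+9]≤n : ∀ s β n → β * β ≤ n → s * (6 * s + 25) ≤ n → s * (2 * β + 9) ≤ n
s*[2β+9]≤n s β n β²≤n N≤n with β ≤? 8 + 3 * s
... | yes β≤8+3s = begin
  s * (2 * β + 9)              ≤⟨ *-monoʳ-≤ s (+-monoˡ-≤ 9 (*-monoʳ-≤ 2 β≤8+3s)) ⟩
  s * (2 * (8 + 3 * s) + 9)    ≡⟨ expand s ⟩
  s * (6 * s + 25)             ≤⟨ N≤n ⟩
  n                            ∎
  where
  open ≤-Reasoning
  expand : ∀ s → s * (2 * (8 + 3 * s) + 9) ≡ s * (6 * s + 25)
  expand = solve-∀
... | no β≰8+3s = begin
  s * (2 * β + 9)              ≤⟨ *-monoʳ-≤ s (+-monoʳ-≤ (2 * β) (≤-trans (m≤m+n 9 (3 * s)) 9+3s≤β)) ⟩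
  s * (2 * β + β)              ≡⟨ regroup s β ⟩
  (3 * s) * β                  ≤⟨ *-monoˡ-≤ β (≤-trans (m≤n+m (3 * s) 9) 9+3s≤β) ⟩
  β * β                        ≤⟨ β²≤n ⟩
  n                            ∎
  where
  open ≤-Reasoning
  9+3s≤β : 9 + 3 * s ≤ β
  9+3s≤β = ≰⇒> β≰8+3s
  regroup : ∀ s β → s * (2 * β + β) ≡ (3 * s) * β
  regroup = solve-∀

count-Tbar-relative-error : ∀ s → ∃ λ N → ∀ n → N ≤ n → s * ∣ 3 * count Tbar n - suc n ∣ < suc n
count-Tbar-relative-error s = s * (6 * s + 25) , λ n N≤n → s≤s (bound n N≤n)
  where
  bound : ∀ n → s * (6 * s + 25) ≤ n → s * ∣ 3 * count Tbar n - suc n ∣ ≤ n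
  bound n N≤n with count-Tbar-error n
  ... | K , 4K≤n , error≤ =
    ≤-trans (*-monoʳ-≤ s error≤) (s*[2β+9]≤n s (ones K) n (≤-trans (ones²≤4k K) 4K≤n) N≤n)

ℤ∣m⊖n∣≡∣m-n∣ : ∀ m n → ℤ.∣ m ⊖ n ∣ ≡ ∣ m - n ∣
ℤ∣m⊖n∣≡∣m-n∣ m n with ≤-total m n
... | inj₁ m≤n = trans (ℤ.∣⊖∣-≤ m≤n) (sym (m≤n⇒∣m-n∣≡n∸m m≤n))
... | inj₂ n≤m = trans (ℤ.∣m⊖n∣≡∣n⊖m∣ m n) (trans (ℤ.∣⊖∣-≤ n≤m) (sym (m≤n⇒∣n-m∣≡n∸m n≤m)))

-- Computed in ℚᵘ, where c/(1+n) − 1/3 stays unreduced with numerator 3c − (1+n) and denominator 3(1+n).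
∣c/[1+n]-1/3∣<ε : ∀ c n ε → 0ℚ ℚ.< ε → ℚ.↧ₙ ε * ∣ 3 * c - suc n ∣ < suc n →
                  ℚ.∣ + c / suc n ℚ.- + 1 / 3 ∣ ℚ.< ε
∣c/[1+n]-1/3∣<ε c n (mkℚ (+ 0) _ _)       (ℚ.*<* (ℤ.+<+ ()))
∣c/[1+n]-1/3∣<ε c n (mkℚ -[1+ _ ] _ _)    (ℚ.*<* ())
∣c/[1+n]-1/3∣<ε c n ε@(mkℚ +[1+ p ] d _) _ small =
  ℚ.toℚᵘ-cancel-< (ℚᵘ.<-respˡ-≃ (ℚᵘ.≃-sym unnormalise) (ℚᵘ.*<* cross-multiplied))
  where
  u v : ℚᵘ
  u = mkℚᵘ (+ c) n
  v = mkℚᵘ (+ 1) 2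
  unnormalise : ℚ.toℚᵘ ℚ.∣ + c / suc n ℚ.- + 1 / 3 ∣ ℚᵘ.≃ ℚᵘ.∣ u ℚᵘ.- v ∣
  unnormalise = ℚᵘ.≃-trans (ℚ.toℚᵘ-homo-∣-∣ (+ c / suc n ℚ.- + 1 / 3)) (ℚᵘ.∣-∣-cong
    (ℚᵘ.≃-trans (ℚ.toℚᵘ-homo-+ (+ c / suc n) (ℚ.- (+ 1 / 3)))
      (ℚᵘ.+-cong (ℚ.toℚᵘ-fromℚᵘ u) (ℚᵘ.≃-trans (ℚ.toℚᵘ-homo‿- (+ 1 / 3)) (ℚᵘ.-‿cong (ℚ.toℚᵘ-fromℚᵘ v))))))
  ∣numerator∣ : ℤ.∣ + c ℤ.* + 3 ℤ.+ (ℤ.- + 1) ℤ.* + suc n ∣ ≡ ∣ 3 * c - suc n ∣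
  ∣numerator∣ = begin
    ℤ.∣ + c ℤ.* + 3 ℤ.+ (ℤ.- + 1) ℤ.* + suc n ∣  ≡⟨ cong ℤ.∣_∣ (cong₂ ℤ._+_ (sym (ℤ.pos-* c 3)) (ℤ.-1*i≡-i (+ suc n))) ⟩
    ℤ.∣ + (c * 3) ℤ.+ ℤ.- + suc n ∣              ≡⟨ cong ℤ.∣_∣ (ℤ.m-n≡m⊖n (c * 3) (suc n)) ⟩
    ℤ.∣ (c * 3) ⊖ suc n ∣                        ≡⟨ ℤ∣m⊖n∣≡∣m-n∣ (c * 3) (suc n) ⟩
    ∣ c * 3 - suc n ∣                            ≡⟨ cong ∣_- suc n ∣ (*-comm c 3) ⟩
    ∣ 3 * c - suc n ∣                            ∎
    where open ≡-Reasoning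
  in-ℕ : ∣ 3 * c - suc n ∣ * suc d < suc p * (suc n * 3)
  in-ℕ = begin-strict
    ∣ 3 * c - suc n ∣ * suc d    ≡⟨ *-comm ∣ 3 * c - suc n ∣ (suc d) ⟩
    suc d * ∣ 3 * c - suc n ∣    <⟨ small ⟩
    suc n                        ≤⟨ m≤m*n (suc n) 3 ⟩
    suc n * 3                    ≤⟨ m≤n*m (suc n * 3) (suc p) ⟩
    suc p * (suc n * 3)          ∎
    where open ≤-Reasoning
  cross-multiplied : + ℤ.∣ + c ℤ.* + 3 ℤ.+ (ℤ.- + 1) ℤ.* + suc n ∣ ℤ.* + suc d ℤ.< +[1+ p ] ℤ.* + (suc n * 3)
  cross-multiplied =
    subst (λ a → + a ℤ.* + suc d ℤ.< +[1+ p ] ℤ.* + (suc n * 3)) (sym ∣numerator∣)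
      (subst₂ ℤ._<_ (ℤ.pos-* ∣ 3 * c - suc n ∣ (suc d)) (ℤ.pos-* (suc p) (suc n * 3)) (ℤ.+<+ in-ℕ))

density-1/3 : ∀ B → (∀ s → ∃ λ N → ∀ n → N ≤ n → s * ∣ 3 * count B n - suc n ∣ < suc n) → HasDensity B (+ 1 / 3)
density-1/3 B small ε 0<ε with small (ℚ.↧ₙ ε)
... | N , relative-error = N , λ n N≤n → ∣c/[1+n]-1/3∣<ε (count B n) n ε 0<ε (relative-error n N≤n)

HasDensity-cong : ∀ {d} → B ≗ B′ → HasDensity B d → HasDensity B′ d
HasDensity-cong {B} {B′} {d} eq density ε 0<ε with density ε 0<ε
... | N , close = N , λ n N≤n → subst (λ c → ℚ.∣ + c / suc n ℚ.- d ∣ ℚ.< ε) (count-cong eq n) (close n N≤n)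

theorem7p1 :
    (∃ λ B → IsReciprocal T B)
    × (∀ B → IsReciprocal T B →
         (∀ n → (B n ≡ true) ⇔ InTbar n) × HasDensity B (+ 1 / 3))
theorem7p1 = (Tbar , T-reciprocal-Tbar) , λ B reciprocal →
  let B≗Tbar = T-reciprocal-unique B reciprocal in
  (λ n → ⇔.trans (mk⇔ (trans (sym (B≗Tbar n))) (trans (B≗Tbar n))) (Tbar⇔InTbar n)) ,
  HasDensity-cong {d = + 1 / 3} (λ n → sym (B≗Tbar n)) (density-1/3 Tbar count-Tbar-relative-error)
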